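{- Let $m>1$ and $n\in\mathbb N_0$, and write $n=a_0+a_1m+\dots+a_sm^s$ with $0\le a_j\le m-1$ for $j=0,\dots,s$. Then $$b_m(mn)\equiv\prod_{i=0}^{s}(a_i+1)+m\Bigg(\sum_{i=1}^{s}\frac{a_i(a_i+1)}{2}\prod_{\substack{j=0\\ j\ne i,\,i-1}}^{s}(a_j+1)\Bigg)\pmod{\mu_2},$$ where $\mu_2=m^2$ if $m$ is odd and $\mu_2=m^2/2$ if $m$ is even.
   Context: $\mathbb N_0=\{0,1,2,\dots\}$. For $m\ge2$ and $n\in\mathbb N_0$, $b_m(n)$ is the number of $m$-ary partitions of $n$, i.e. the number of representations $n=n_0+n_1m+\dots+n_tm^t$ with all $n_i\in\mathbb N_0$. Empty sums are $0$ and empty products are $1$. -}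

module Defs where

open import Data.Nat using (ℕ; zero; suc; _+_; _*_; _∸_; _^_; _≤ᵇ_; _≡ᵇ_; _/_; _%_)
open import Data.Fin using (Fin; zero; suc; toℕ)
open import Data.Bool using (if_then_else_; _∨_)
open import Data.Integer as ℤ using (ℤ; +_)
open import Data.Integer.Divisibility using (_∣_)

sumF : ∀ {k} → (Fin k → ℕ) → ℕ
sumF {zero}  f = 0
sumF {suc k} f = f zero + sumF (λ i → f (suc i))

prodF : ∀ {k} → (Fin k → ℕ) → ℕ
prodF {zero}  f = 1
prodF {suc k} f = f zero * prodF (λ i → f (suc i))

sumUpTo : ℕ → (ℕ → ℕ) → ℕ
sumUpTo zero    g = g 0
sumUpTo (suc n) g = sumUpTo n g + g (suc n)

-- reps m t n = number of tuples (n_0,...,n_t) ∈ ℕ^(t+1) with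
--   n = n_0 + n_1 m + ... + n_t m^t.
-- (n_t ranges over k with k * m^t ≤ n; k ≤ n suffices as m^t ≥ 1 for m ≥ 1.)
reps : ℕ → ℕ → ℕ → ℕ
reps m zero    n = 1
reps m (suc t) n =
  sumUpTo n (λ k → if k * m ^ suc t ≤ᵇ n then reps m t (n ∸ k * m ^ suc t) else 0)

-- b m n = number of m-ary partitions of n.  For m ≥ 2 any representation
-- has n_i = 0 whenever m^i > n, in particular for i ≥ n+1 (m^(n) > n for n ≥ 1),
-- so counting representations with t = n is the full count.
b : ℕ → ℕ → ℕ
b m n = reps m n n

μ₂ : ℕ → ℕ
μ₂ m = if m % 2 ≡ᵇ 0 then (m * m) / 2 else m * m

_≡_[mod_] : ℕ → ℕ → ℕ → Set
x ≡ y [mod q ] = (+ q) ∣ ((+ x) ℤ.- (+ y))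

{-# OPTIONS --safe #-}
-- Let p t x count the representations of x with parts 1, m, …, m^t, and put
-- S₁ t n = Σ_{j ≤ n} p t j and S₂ t n = Σ_{j < n} S₁ t j.  For t large, b_m(mn) = S₁ t n.
-- Splitting off the lowest digit, n = r + m q with r < m, gives
--   S₁ (t+1) (r + m q) = m · S₂ t q + (r + 1) · S₁ t q,
-- so modulo m, S₁ t n ≡ ∏ (a_i + 1) by induction on the number of digits.  The same
-- computation for S₂ shows m · S₂ (t+1) (r + m q) ≡ m · r(r+1)/2 · S₁ t q modulo μ₂,
-- since μ₂ divides both m² and m · m(m+1)/2; multiplying by m lifts the congruence
-- modulo m for S₁ t q to one modulo m², hence modulo μ₂.  Feeding both into the
-- recursion for S₁ and inducting on the digits once more gives the theorem.
module Submission where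

open import Defs
open import Data.Nat using (ℕ; suc; _+_; _*_; _^_; _<_; _/_; _≡ᵇ_)
open import Data.Fin using (Fin; suc; toℕ)
open import Data.Bool using (if_then_else_; _∨_)
open import Relation.Binary.PropositionalEquality using (_≡_)

open import Data.Nat using (zero; _≤_; _∸_; _≤ᵇ_; _%_; NonZero; >-nonZero⁻¹; z≤n; s≤s; s≤s⁻¹)
open import Data.Nat.Properties
open import Data.Nat.DivMod
open import Data.Nat.Induction using (<-rec)
import Data.Nat.Divisibility as ℕ∣
open import Data.Integer.Divisibility using (_∣_)
open import Data.Fin using (zero)
open import Data.Bool using (T; true; false)
open import Data.Bool.Properties using (T-≡)
open import Data.Product using (_×_; _,_; proj₁; proj₂)
open import Data.Unit using (tt)
open import Function using (_∘_; Equivalence)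
open import Relation.Nullary using (¬_; yes; no; contradiction)
open import Relation.Binary.Bundles using (Setoid)
open import Relation.Binary.PropositionalEquality
  using (refl; sym; trans; cong; cong₂; subst; subst₂; module ≡-Reasoning)
import Data.Integer as ℤ
import Data.Integer.Properties as ℤ
import Data.Integer.Divisibility.Signed as ℤ∣
open import Data.Integer.Tactic.RingSolver using () renaming (solve-∀ to solve-ℤ)
open import Data.Nat.Tactic.RingSolver using (solve-∀)
import Algebra.Properties.CommutativeSemigroup as CommSemigroup
import Relation.Binary.Reasoning.Setoid as SetoidReasoning

if-≤ᵇ-true : ∀ {a b y} → a ≤ b → (if a ≤ᵇ b then y else 0) ≡ y
if-≤ᵇ-true a≤b rewrite Equivalence.to T-≡ (≤⇒≤ᵇ a≤b) = refl

if-≤ᵇ-false : ∀ {a b y} → ¬ a ≤ b → (if a ≤ᵇ b then y else 0) ≡ 0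
if-≤ᵇ-false {a} {b} a≰b with a ≤ᵇ b in eq
... | false = refl
... | true  = contradiction (≤ᵇ⇒≤ a b (subst T (sym eq) tt)) a≰b

∑< : ℕ → (ℕ → ℕ) → ℕ
∑< zero    g = 0
∑< (suc n) g = ∑< n g + g n

syntax ∑< n (λ j → e) = ∑[ j < n ] e

module _ where
  open ≡-Reasoning
  open CommSemigroup +-commutativeSemigroup using () renaming (interchange to +-interchange)

  ∑<-cong : ∀ n {f g : ℕ → ℕ} → (∀ j → j < n → f j ≡ g j) → ∑< n f ≡ ∑< n g
  ∑<-cong zero    f≗g = refl
  ∑<-cong (suc n) f≗g = cong₂ _+_ (∑<-cong n (λ j j<n → f≗g j (m<n⇒m<1+n j<n))) (f≗g n ≤-refl)

  ∑<-const : ∀ n c → ∑[ j < n ] c ≡ n * c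
  ∑<-const zero    c = refl
  ∑<-const (suc n) c = trans (cong (_+ c) (∑<-const n c)) (+-comm (n * c) c)

  ∑<-vanish : ∀ n {g : ℕ → ℕ} → (∀ j → j < n → g j ≡ 0) → ∑< n g ≡ 0
  ∑<-vanish n g≗0 = trans (∑<-cong n g≗0) (trans (∑<-const n 0) (*-zeroʳ n))

  ∑<-+ : ∀ a k (g : ℕ → ℕ) → ∑< (a + k) g ≡ ∑< a g + ∑[ j < k ] g (a + j)
  ∑<-+ a zero    g = trans (cong (λ n → ∑< n g) (+-identityʳ a)) (sym (+-identityʳ _))
  ∑<-+ a (suc k) g = begin
    ∑< (a + suc k) g                              ≡⟨ cong (λ n → ∑< n g) (+-suc a k) ⟩
    ∑< (a + k) g + g (a + k)                      ≡⟨ cong (_+ g (a + k)) (∑<-+ a k g) ⟩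
    ∑< a g + ∑[ j < k ] g (a + j) + g (a + k)     ≡⟨ +-assoc (∑< a g) _ _ ⟩
    ∑< a g + ∑[ j < suc k ] g (a + j)             ∎

  ∑<-suc : ∀ n (g : ℕ → ℕ) → ∑< (suc n) g ≡ g 0 + ∑[ j < n ] g (suc j)
  ∑<-suc n g = ∑<-+ 1 n g

  ∑<-distrib-+ : ∀ n (f g : ℕ → ℕ) → ∑[ j < n ] (f j + g j) ≡ ∑< n f + ∑< n g
  ∑<-distrib-+ zero    f g = refl
  ∑<-distrib-+ (suc n) f g =
    trans (cong (_+ (f n + g n)) (∑<-distrib-+ n f g)) (+-interchange (∑< n f) (∑< n g) (f n) (g n))

  ∑<-*ˡ : ∀ n c (g : ℕ → ℕ) → ∑[ j < n ] (c * g j) ≡ c * ∑< n g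
  ∑<-*ˡ zero    c g = sym (*-zeroʳ c)
  ∑<-*ˡ (suc n) c g = trans (cong (_+ c * g n) (∑<-*ˡ n c g)) (sym (*-distribˡ-+ c (∑< n g) (g n)))

  ∑<-*ʳ : ∀ n c (g : ℕ → ℕ) → ∑[ j < n ] (g j * c) ≡ ∑< n g * c
  ∑<-*ʳ zero    c g = refl
  ∑<-*ʳ (suc n) c g = trans (cong (_+ g n * c) (∑<-*ʳ n c g)) (sym (*-distribʳ-+ c (∑< n g) (g n)))

  ∑<-blocks : ∀ m q (g : ℕ → ℕ) → ∑< (m * q) g ≡ ∑[ i < q ] ∑[ r < m ] g (m * i + r)
  ∑<-blocks m zero    g = cong (λ n → ∑< n g) (*-zeroʳ m)
  ∑<-blocks m (suc q) g = begin
    ∑< (m * suc q) g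
      ≡⟨ cong (λ n → ∑< n g) (trans (*-suc m q) (+-comm m (m * q))) ⟩
    ∑< (m * q + m) g
      ≡⟨ ∑<-+ (m * q) m g ⟩
    ∑< (m * q) g + ∑[ r < m ] g (m * q + r)
      ≡⟨ cong (_+ ∑[ r < m ] g (m * q + r)) (∑<-blocks m q g) ⟩
    ∑[ i < suc q ] ∑[ r < m ] g (m * i + r) ∎

  ∑<-guarded : ∀ {M n} (f : ℕ → ℕ) → M ≤ n →
    ∑[ j < n ] (if M ≤ᵇ j then f (j ∸ M) else 0) ≡ ∑< (n ∸ M) f
  ∑<-guarded {M} {n} f M≤n = begin
    ∑< n g                                  ≡⟨ cong (λ k → ∑< k g) (sym (m+[n∸m]≡n M≤n)) ⟩
    ∑< (M + (n ∸ M)) g                      ≡⟨ ∑<-+ M (n ∸ M) g ⟩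
    ∑< M g + ∑[ i < n ∸ M ] g (M + i)       ≡⟨ cong₂ _+_ (∑<-vanish M (λ j j<M → if-≤ᵇ-false (<⇒≱ j<M)))
                                                         (∑<-cong (n ∸ M) (λ i _ → shifted i)) ⟩
    0 + ∑< (n ∸ M) f                        ∎
    where
    g : ℕ → ℕ
    g j = if M ≤ᵇ j then f (j ∸ M) else 0
    shifted : ∀ i → g (M + i) ≡ f i
    shifted i = trans (if-≤ᵇ-true (m≤m+n M i)) (cong f (m+n∸m≡n M i))

  ∑<-digit : ∀ m q k (g : ℕ → ℕ) →
    ∑< (k + m * q) g ≡ ∑[ i < q ] ∑[ j < m ] g (m * i + j) + ∑[ j < k ] g (m * q + j)
  ∑<-digit m q k g = begin
    ∑< (k + m * q) g
      ≡⟨ cong (λ n → ∑< n g) (+-comm k (m * q)) ⟩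
    ∑< (m * q + k) g
      ≡⟨ ∑<-+ (m * q) k g ⟩
    ∑< (m * q) g + ∑[ j < k ] g (m * q + j)
      ≡⟨ cong (_+ ∑[ j < k ] g (m * q + j)) (∑<-blocks m q g) ⟩
    ∑[ i < q ] ∑[ j < m ] g (m * i + j) + ∑[ j < k ] g (m * q + j) ∎

  ∑<-extend : ∀ {n n′} (g : ℕ → ℕ) → n ≤ n′ → (∀ j → n ≤ j → g j ≡ 0) → ∑< n′ g ≡ ∑< n g
  ∑<-extend {n} {n′} g n≤n′ g≗0 = begin
    ∑< n′ g                                  ≡⟨ cong (λ k → ∑< k g) (sym (m+[n∸m]≡n n≤n′)) ⟩
    ∑< (n + (n′ ∸ n)) g                      ≡⟨ ∑<-+ n (n′ ∸ n) g ⟩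
    ∑< n g + ∑[ i < n′ ∸ n ] g (n + i)       ≡⟨ cong (∑< n g +_) (∑<-vanish (n′ ∸ n) (λ i _ → vanish i)) ⟩
    ∑< n g + 0                               ≡⟨ +-identityʳ _ ⟩
    ∑< n g                                   ∎
    where
    vanish : ∀ i → g (n + i) ≡ 0
    vanish i = g≗0 (n + i) (m≤m+n n i)

  sumUpTo≡∑< : ∀ n g → sumUpTo n g ≡ ∑< (suc n) g
  sumUpTo≡∑< zero    g = refl
  sumUpTo≡∑< (suc n) g = cong (_+ g (suc n)) (sumUpTo≡∑< n g)

triangle : ℕ → ℕ
triangle n = ∑[ j < n ] suc j

module _ where
  open ≡-Reasoning

  ∑<-arith : ∀ n x y → ∑[ j < n ] (x + suc j * y) ≡ n * x + triangle n * y
  ∑<-arith n x y = trans (∑<-distrib-+ n (λ _ → x) (λ j → suc j * y))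
                         (cong₂ _+_ (∑<-const n x) (∑<-*ʳ n y suc))

  triangle-*2 : ∀ n → triangle n * 2 ≡ n * suc n
  triangle-*2 zero    = refl
  triangle-*2 (suc n) = begin
    (triangle n + suc n) * 2      ≡⟨ *-distribʳ-+ 2 (triangle n) (suc n) ⟩
    triangle n * 2 + suc n * 2    ≡⟨ cong (_+ suc n * 2) (triangle-*2 n) ⟩
    n * suc n + suc n * 2         ≡⟨ cong (_+ suc n * 2) (*-comm n (suc n)) ⟩
    suc n * n + suc n * 2         ≡⟨ *-distribˡ-+ (suc n) n 2 ⟨
    suc n * (n + 2)               ≡⟨ cong (suc n *_) (+-comm n 2) ⟩
    suc n * suc (suc n)           ∎

  triangle≡ : ∀ n → triangle n ≡ n * (n + 1) / 2
  triangle≡ n = begin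
    triangle n                ≡⟨ m*n/n≡m (triangle n) 2 ⟨
    triangle n * 2 / 2        ≡⟨ cong (_/ 2) (trans (triangle-*2 n) (cong (n *_) (+-comm 1 n))) ⟩
    n * (n + 1) / 2           ∎

-- The congruence of Defs behind a record, so that unification recovers both sides.
infix 4 _≋_[mod_]
record _≋_[mod_] (x y q : ℕ) : Set where
  constructor wrap
  field unwrap : x ≡ y [mod q ]
open _≋_[mod_]

module _ {q : ℕ} where

  private
    signed : ∀ {x y} → x ≋ y [mod q ] → ℤ.+ q ℤ∣.∣ (ℤ.+ x ℤ.- ℤ.+ y)
    signed = ℤ∣.∣ᵤ⇒∣ ∘ unwrap

  ≋-refl : ∀ {x} → x ≋ x [mod q ]
  ≋-refl {x} = wrap (subst (ℤ.+ q ∣_) (sym (ℤ.+-inverseʳ (ℤ.+ x))) (ℕ∣._∣0 q))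

  ≡⇒≋ : ∀ {x y} → x ≡ y → x ≋ y [mod q ]
  ≡⇒≋ refl = ≋-refl

  ≋-sym : ∀ {x y} → x ≋ y [mod q ] → y ≋ x [mod q ]
  ≋-sym {x} {y} (wrap x≡y) = wrap (subst (q ℕ∣.∣_) (ℤ.∣i-j∣≡∣j-i∣ (ℤ.+ x) (ℤ.+ y)) x≡y)

  ≋-trans : ∀ {x y z} → x ≋ y [mod q ] → y ≋ z [mod q ] → x ≋ z [mod q ]
  ≋-trans {x} {y} {z} x≋y y≋z =
    wrap (ℤ∣.∣⇒∣ᵤ (subst (ℤ.+ q ℤ∣.∣_) (telescope (ℤ.+ x) (ℤ.+ y) (ℤ.+ z))
                         (ℤ∣.∣m∣n⇒∣m+n (signed x≋y) (signed y≋z))))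
    where
    telescope : ∀ X Y Z → (X ℤ.- Y) ℤ.+ (Y ℤ.- Z) ≡ X ℤ.- Z
    telescope = solve-ℤ

  ≋-+ : ∀ {x x′ y y′} → x ≋ x′ [mod q ] → y ≋ y′ [mod q ] → x + y ≋ x′ + y′ [mod q ]
  ≋-+ {x} {x′} {y} {y′} x≋x′ y≋y′ =
    wrap (ℤ∣.∣⇒∣ᵤ (subst (ℤ.+ q ℤ∣.∣_) difference (ℤ∣.∣m∣n⇒∣m+n (signed x≋x′) (signed y≋y′))))
    where
    regroup : ∀ X X′ Y Y′ → (X ℤ.- X′) ℤ.+ (Y ℤ.- Y′) ≡ (X ℤ.+ Y) ℤ.- (X′ ℤ.+ Y′)
    regroup = solve-ℤ
    difference : (ℤ.+ x ℤ.- ℤ.+ x′) ℤ.+ (ℤ.+ y ℤ.- ℤ.+ y′) ≡ ℤ.+ (x + y) ℤ.- ℤ.+ (x′ + y′)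
    difference = trans (regroup (ℤ.+ x) (ℤ.+ x′) (ℤ.+ y) (ℤ.+ y′))
                       (sym (cong₂ ℤ._-_ (ℤ.pos-+ x y) (ℤ.pos-+ x′ y′)))

  ≋-+-multiple : ∀ {d x} → q ℕ∣.∣ d → d + x ≋ x [mod q ]
  ≋-+-multiple {d} {x} q∣d = wrap (subst (λ z → q ℕ∣.∣ ℤ.∣ z ∣) (sym difference) q∣d)
    where
    cancel : ∀ D X → (D ℤ.+ X) ℤ.- X ≡ D
    cancel = solve-ℤ
    difference : ℤ.+ (d + x) ℤ.- ℤ.+ x ≡ ℤ.+ d
    difference = trans (cong (ℤ._- ℤ.+ x) (ℤ.pos-+ d x)) (cancel (ℤ.+ d) (ℤ.+ x))

≋-∣ : ∀ {p q x y} → p ℕ∣.∣ q → x ≋ y [mod q ] → x ≋ y [mod p ]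
≋-∣ p∣q (wrap x≡y) = wrap (ℕ∣.∣-trans p∣q x≡y)

≋-scale : ∀ {q x y} c → x ≋ y [mod q ] → c * x ≋ c * y [mod c * q ]
≋-scale {q} {x} {y} c (wrap x≡y) = wrap (subst (c * q ℕ∣.∣_) (sym difference) (ℕ∣.*-monoʳ-∣ c x≡y))
  where
  open ≡-Reasoning
  factor : ∀ C X Y → C ℤ.* X ℤ.- C ℤ.* Y ≡ C ℤ.* (X ℤ.- Y)
  factor = solve-ℤ
  difference : ℤ.∣ ℤ.+ (c * x) ℤ.- ℤ.+ (c * y) ∣ ≡ c * ℤ.∣ ℤ.+ x ℤ.- ℤ.+ y ∣
  difference = begin
    ℤ.∣ ℤ.+ (c * x) ℤ.- ℤ.+ (c * y) ∣         ≡⟨ cong ℤ.∣_∣ (cong₂ ℤ._-_ (ℤ.pos-* c x) (ℤ.pos-* c y)) ⟩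
    ℤ.∣ ℤ.+ c ℤ.* ℤ.+ x ℤ.- ℤ.+ c ℤ.* ℤ.+ y ∣ ≡⟨ cong ℤ.∣_∣ (factor (ℤ.+ c) (ℤ.+ x) (ℤ.+ y)) ⟩
    ℤ.∣ ℤ.+ c ℤ.* (ℤ.+ x ℤ.- ℤ.+ y) ∣         ≡⟨ ℤ.abs-* (ℤ.+ c) (ℤ.+ x ℤ.- ℤ.+ y) ⟩
    c * ℤ.∣ ℤ.+ x ℤ.- ℤ.+ y ∣                 ∎

≋-*ˡ : ∀ {q x y} c → x ≋ y [mod q ] → c * x ≋ c * y [mod q ]
≋-*ˡ c x≋y = ≋-∣ (ℕ∣.n∣m*n c) (≋-scale c x≋y)

≋-setoid : ℕ → Setoid _ _
≋-setoid q = record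
  { Carrier       = ℕ
  ; _≈_           = _≋_[mod q ]
  ; isEquivalence = record { refl = ≋-refl ; sym = ≋-sym ; trans = ≋-trans }
  }

module ≋-Reasoning (q : ℕ) = SetoidReasoning (≋-setoid q)

μ₂-divides : ∀ m → μ₂ m ℕ∣.∣ m * m × μ₂ m ℕ∣.∣ m * triangle m
μ₂-divides m with m % 2 | m≡m%n+[m/n]*n m 2 | m%n<n m 2
... | 0 | m≡h*2 | _ =
  subst (ℕ∣._∣ m * m) (sym half) (ℕ∣.*-monoʳ-∣ m (subst (h ℕ∣.∣_) (sym m≡h*2) (ℕ∣.m∣m*n 2))) ,
  subst₂ ℕ∣._∣_ (sym half) (cong (m *_) (sym triangle≡h*[m+1])) (ℕ∣.*-monoʳ-∣ m (ℕ∣.m∣m*n (suc m)))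
  where
  open ≡-Reasoning
  h : ℕ
  h = m / 2
  half : m * m / 2 ≡ m * h
  half = trans (cong (λ k → m * k / 2) m≡h*2)
               (trans (cong (_/ 2) (sym (*-assoc m h 2))) (m*n/n≡m (m * h) 2))
  triangle≡h*[m+1] : triangle m ≡ h * suc m
  triangle≡h*[m+1] = *-cancelʳ-≡ (triangle m) (h * suc m) 2 (begin
    triangle m * 2     ≡⟨ triangle-*2 m ⟩
    m * suc m          ≡⟨ cong (_* suc m) m≡h*2 ⟩
    h * 2 * suc m      ≡⟨ *-assoc h 2 (suc m) ⟩
    h * (2 * suc m)    ≡⟨ cong (h *_) (*-comm 2 (suc m)) ⟩
    h * (suc m * 2)    ≡⟨ *-assoc h (suc m) 2 ⟨
    h * suc m * 2      ∎)
... | 1 | m≡1+h*2 | _ =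
  ℕ∣.∣-refl , ℕ∣.*-monoʳ-∣ m (subst (m ℕ∣.∣_) (sym triangle≡m*[h+1]) (ℕ∣.m∣m*n (suc h)))
  where
  open ≡-Reasoning
  h : ℕ
  h = m / 2
  triangle≡m*[h+1] : triangle m ≡ m * suc h
  triangle≡m*[h+1] = *-cancelʳ-≡ (triangle m) (m * suc h) 2 (begin
    triangle m * 2     ≡⟨ triangle-*2 m ⟩
    m * suc m          ≡⟨ cong (λ k → m * suc k) m≡1+h*2 ⟩
    m * (suc h * 2)    ≡⟨ *-assoc m (suc h) 2 ⟨
    m * suc h * 2      ∎)
... | suc (suc _) | _ | s≤s (s≤s ())

module _ {M : ℕ} (f : ℕ → ℕ) where
  open ≡-Reasoning

  -- reps m (suc t) is ∑multiples (reps m t) with M = m ^ suc t.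
  ∑multiples : ℕ → ℕ
  ∑multiples x = sumUpTo x (λ k → if k * M ≤ᵇ x then f (x ∸ k * M) else 0)

  ∑multiples-< : ∀ {x} → x < M → ∑multiples x ≡ f x
  ∑multiples-< {x} x<M = begin
    sumUpTo x g                      ≡⟨ sumUpTo≡∑< x g ⟩
    ∑< (suc x) g                     ≡⟨ ∑<-suc x g ⟩
    f x + ∑[ k < x ] g (suc k)       ≡⟨ cong (f x +_) (∑<-vanish x (λ k _ → if-≤ᵇ-false (too-big k))) ⟩
    f x + 0                          ≡⟨ +-identityʳ (f x) ⟩
    f x                              ∎
    where
    g : ℕ → ℕ
    g k = if k * M ≤ᵇ x then f (x ∸ k * M) else 0
    too-big : ∀ k → ¬ M + k * M ≤ x
    too-big k le = <⇒≱ x<M (≤-trans (m≤m+n M (k * M)) le)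

  ∑multiples-≥ : ∀ {x} .{{_ : NonZero M}} → M ≤ x → ∑multiples x ≡ f x + ∑multiples (x ∸ M)
  ∑multiples-≥ {x} M≤x = begin
    sumUpTo x g                      ≡⟨ sumUpTo≡∑< x g ⟩
    ∑< (suc x) g                     ≡⟨ ∑<-suc x g ⟩
    f x + ∑[ k < x ] g (suc k)       ≡⟨ cong (f x +_) (∑<-cong x (λ k _ → shift k)) ⟩
    f x + ∑< x g′                    ≡⟨ cong (f x +_) (∑<-extend g′ y<x vanish) ⟩
    f x + ∑< (suc y) g′              ≡⟨ cong (f x +_) (sumUpTo≡∑< y g′) ⟨
    f x + sumUpTo y g′               ∎
    where
    y : ℕ
    y = x ∸ M
    y<x : y < x
    y<x = ∸-monoʳ-< (>-nonZero⁻¹ M) M≤x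
    g g′ : ℕ → ℕ
    g  k = if k * M ≤ᵇ x then f (x ∸ k * M) else 0
    g′ k = if k * M ≤ᵇ y then f (y ∸ k * M) else 0
    M+kM≤x : ∀ k → k * M ≤ y → M + k * M ≤ x
    M+kM≤x k kM≤y = subst (_≤ x) (+-comm (k * M) M) (m≤o∸n⇒m+n≤o (k * M) M≤x kM≤y)
    shift : ∀ k → g (suc k) ≡ g′ k
    shift k with k * M ≤? y
    ... | yes kM≤y = begin
      g (suc k)               ≡⟨ if-≤ᵇ-true (M+kM≤x k kM≤y) ⟩
      f (x ∸ (M + k * M))     ≡⟨ cong f (∸-+-assoc x M (k * M)) ⟨
      f (y ∸ k * M)           ≡⟨ if-≤ᵇ-true kM≤y ⟨
      g′ k                    ∎
    ... | no  kM≰y = trans (if-≤ᵇ-false (kM≰y ∘ kM≤y)) (sym (if-≤ᵇ-false kM≰y))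
      where
      kM≤y : M + k * M ≤ x → k * M ≤ y
      kM≤y le = m+n≤o⇒m≤o∸n (k * M) (subst (_≤ x) (+-comm M (k * M)) le)
    vanish : ∀ k → suc y ≤ k → g′ k ≡ 0
    vanish k y<k = if-≤ᵇ-false (λ kM≤y → <⇒≱ y<k (≤-trans (m≤m*n k M) kM≤y))

sumF-cong : ∀ {k} {f g : Fin k → ℕ} → (∀ i → f i ≡ g i) → sumF f ≡ sumF g
sumF-cong {zero}  f≗g = refl
sumF-cong {suc k} f≗g = cong₂ _+_ (f≗g zero) (sumF-cong (f≗g ∘ suc))

sumF-*ˡ : ∀ {k} c (f : Fin k → ℕ) → sumF (λ i → c * f i) ≡ c * sumF f
sumF-*ˡ {zero}  c f = sym (*-zeroʳ c)
sumF-*ˡ {suc k} c f = trans (cong (c * f zero +_) (sumF-*ˡ c (f ∘ suc))) (sym (*-distribˡ-+ c (f zero) _))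

sumF-*ˡ-inner : ∀ {k} c (f g : Fin k → ℕ) → sumF (λ i → f i * (c * g i)) ≡ c * sumF (λ i → f i * g i)
sumF-*ˡ-inner c f g = trans (sumF-cong (λ i → x∙yz≈y∙xz (f i) c (g i))) (sumF-*ˡ c (λ i → f i * g i))
  where open CommSemigroup *-commutativeSemigroup using (x∙yz≈y∙xz)

∏⁺ : ∀ {k} → (Fin k → ℕ) → ℕ
∏⁺ a = prodF (λ i → a i + 1)

∏⁺-one : (a : Fin 1 → ℕ) → ∏⁺ a ≡ suc (a zero)
∏⁺-one a = trans (*-identityʳ (a zero + 1)) (+-comm (a zero) 1)

[m*i+j]/m≡i : ∀ m .{{_ : NonZero m}} i {j} → j < m → (m * i + j) / m ≡ i
[m*i+j]/m≡i m i {j} j<m = begin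
  (m * i + j) / m     ≡⟨ +-distrib-/-∣ˡ j {m} (ℕ∣.m∣m*n i) ⟩
  m * i / m + j / m   ≡⟨ cong₂ _+_ (trans (cong (_/ m) (*-comm m i)) (m*n/n≡m i m)) (m<n⇒m/n≡0 j<m) ⟩
  i + 0               ≡⟨ +-identityʳ i ⟩
  i                   ∎
  where open ≡-Reasoning

n<m^n : ∀ {m} → 1 < m → ∀ n → n < m ^ n
n<m^n 1<m zero    = s≤s z≤n
n<m^n {m} 1<m (suc n) = ≤-<-trans (n<m^n 1<m n) (^-monoʳ-< m 1<m (n<1+n n))

module _ (m : ℕ) .{{_ : NonZero m}} where

  -- Apart from its n₀ parts 1, a representation of x is m times one of some j ≤ x / m.
  p : ℕ → ℕ → ℕ
  p zero    x = 1
  p (suc t) x = ∑[ j < suc (x / m) ] p t j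

  S₁ : ℕ → ℕ → ℕ
  S₁ t n = ∑[ j < suc n ] p t j

  S₂ : ℕ → ℕ → ℕ
  S₂ t n = ∑[ j < n ] S₁ t j

  p-<m : ∀ t {x} → x < m → p t x ≡ 1
  p-<m zero    x<m = refl
  p-<m (suc t) x<m = trans (cong (S₁ t) (m<n⇒m/n≡0 x<m)) (p-<m t (>-nonZero⁻¹ m))

  S₁-zero : ∀ n → S₁ 0 n ≡ suc n
  S₁-zero n = trans (∑<-const (suc n) 1) (*-identityʳ (suc n))

  p-below : ∀ t {x} → x < m ^ suc t → p (suc t) x ≡ p t x
  p-below zero    {x} x<m =
    trans (S₁-zero (x / m)) (cong suc (m<n⇒m/n≡0 (subst (x <_) (*-identityʳ m) x<m)))
  p-below (suc t) {x} x<M =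
    ∑<-cong (suc (x / m)) (λ j j≤x/m → p-below t (≤-<-trans (s≤s⁻¹ j≤x/m) x/m<M′))
    where
    x/m<M′ : x / m < m ^ suc t
    x/m<M′ = m<n*o⇒m/o<n (subst (x <_) (*-comm m (m ^ suc t)) x<M)

  p-above : ∀ t {x} → m ^ suc t ≤ x → p (suc t) x ≡ p t x + p (suc t) (x ∸ m ^ suc t)
  p-above zero {x} m≤x = begin
    S₁ 0 (x / m)                 ≡⟨ S₁-zero (x / m) ⟩
    suc (x / m)                  ≡⟨ cong suc (m/n≡1+[m∸n]/n (subst (_≤ x) (*-identityʳ m) m≤x)) ⟩
    suc (suc ((x ∸ m) / m))      ≡⟨ cong (λ k → suc (suc ((x ∸ k) / m))) (*-identityʳ m) ⟨
    1 + suc ((x ∸ m * 1) / m)    ≡⟨ cong (1 +_) (S₁-zero ((x ∸ m * 1) / m)) ⟨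
    1 + S₁ 0 ((x ∸ m * 1) / m)   ∎
    where open ≡-Reasoning
  p-above (suc t) {x} M≤x = begin
    ∑[ j < suc N ] p (suc t) j
      ≡⟨ ∑<-cong (suc N) (λ j _ → split j) ⟩
    ∑[ j < suc N ] (p t j + excess j)
      ≡⟨ ∑<-distrib-+ (suc N) (p t) excess ⟩
    p (suc t) x + ∑< (suc N) excess
      ≡⟨ cong (p (suc t) x +_) (∑<-guarded (p (suc t)) (m≤n⇒m≤1+n M′≤N)) ⟩
    p (suc t) x + ∑< (suc N ∸ M′) (p (suc t))
      ≡⟨ cong (λ k → p (suc t) x + ∑< k (p (suc t))) rest ⟩
    p (suc t) x + p (suc (suc t)) (x ∸ M)      ∎
    where
    open ≡-Reasoning
    M′ M N : ℕ
    M′ = m ^ suc t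
    M  = m ^ suc (suc t)
    N  = x / m
    excess : ℕ → ℕ
    excess j = if M′ ≤ᵇ j then p (suc t) (j ∸ M′) else 0
    split : ∀ j → p (suc t) j ≡ p t j + excess j
    split j with M′ ≤? j
    ... | yes M′≤j = trans (p-above t M′≤j) (cong (p t j +_) (sym (if-≤ᵇ-true M′≤j)))
    ... | no  M′≰j = begin
      p (suc t) j        ≡⟨ p-below t (≰⇒> M′≰j) ⟩
      p t j              ≡⟨ +-identityʳ (p t j) ⟨
      p t j + 0          ≡⟨ cong (p t j +_) (if-≤ᵇ-false M′≰j) ⟨
      p t j + excess j   ∎
    M′≤N : M′ ≤ N
    M′≤N = subst (_≤ N) (m*n/n≡m M′ m) (/-monoˡ-≤ m (subst (_≤ x) (*-comm m M′) M≤x))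
    rest : suc N ∸ M′ ≡ suc ((x ∸ M) / m)
    rest = begin
      suc N ∸ M′              ≡⟨ +-∸-assoc 1 M′≤N ⟩
      suc (N ∸ M′)            ≡⟨ cong suc ([m∸n*o]/o≡m/o∸n x M′ m) ⟨
      suc ((x ∸ M′ * m) / m)  ≡⟨ cong (λ k → suc ((x ∸ k) / m)) (*-comm M′ m) ⟩
      suc ((x ∸ M) / m)       ∎

  -- reps removes the largest parts first and p the smallest, but both satisfy the
  -- recursion p-below / p-above, which determines them by induction on t and then x.
  reps≡p : ∀ t x → reps m t x ≡ p t x
  reps≡p zero    x = refl
  reps≡p (suc t)   = <-rec _ step
    where
    open ≡-Reasoning
    M : ℕ
    M = m ^ suc t
    instance
      M≢0 : NonZero M
      M≢0 = m^n≢0 m (suc t)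
    step : ∀ x → (∀ {y} → y < x → reps m (suc t) y ≡ p (suc t) y) → reps m (suc t) x ≡ p (suc t) x
    step x rec with M ≤? x
    ... | no  M≰x = begin
      reps m (suc t) x                       ≡⟨ ∑multiples-< (reps m t) (≰⇒> M≰x) ⟩
      reps m t x                             ≡⟨ reps≡p t x ⟩
      p t x                                  ≡⟨ p-below t (≰⇒> M≰x) ⟨
      p (suc t) x                            ∎
    ... | yes M≤x = begin
      reps m (suc t) x                       ≡⟨ ∑multiples-≥ (reps m t) M≤x ⟩
      reps m t x + reps m (suc t) (x ∸ M)    ≡⟨ cong₂ _+_ (reps≡p t x) (rec (∸-monoʳ-< (>-nonZero⁻¹ M) M≤x)) ⟩
      p t x + p (suc t) (x ∸ M)              ≡⟨ p-above t M≤x ⟨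
      p (suc t) x                            ∎

  p-stable : ∀ d t {x} → x < m ^ suc t → p (d + t) x ≡ p t x
  p-stable zero    t x<M = refl
  p-stable (suc d) t x<M =
    trans (p-below (d + t) (<-≤-trans x<M (^-monoʳ-≤ m (s≤s (m≤n+m t d))))) (p-stable d t x<M)

  p-block : ∀ t i {k} → k ≤ m → ∑[ j < k ] p (suc t) (m * i + j) ≡ k * S₁ t i
  p-block t i {k} k≤m =
    trans (∑<-cong k (λ j j<k → cong (S₁ t) ([m*i+j]/m≡i m i (<-≤-trans j<k k≤m)))) (∑<-const k (S₁ t i))

  S₁-digit : ∀ t {r} q → r < m → S₁ (suc t) (r + m * q) ≡ m * S₂ t q + suc r * S₁ t q
  S₁-digit t {r} q r<m = begin
    ∑< (suc r + m * q) (p (suc t))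
      ≡⟨ ∑<-digit m q (suc r) (p (suc t)) ⟩
    ∑[ i < q ] ∑[ j < m ] p (suc t) (m * i + j) + ∑[ j < suc r ] p (suc t) (m * q + j)
      ≡⟨ cong₂ _+_ (∑<-cong q (λ i _ → p-block t i ≤-refl)) (p-block t q r<m) ⟩
    ∑[ i < q ] (m * S₁ t i) + suc r * S₁ t q
      ≡⟨ cong (_+ suc r * S₁ t q) (∑<-*ˡ q m (S₁ t)) ⟩
    m * S₂ t q + suc r * S₁ t q ∎
    where open ≡-Reasoning

  S₁-block : ∀ t i {k} → k ≤ m → ∑[ j < k ] S₁ (suc t) (m * i + j) ≡ k * (m * S₂ t i) + triangle k * S₁ t i
  S₁-block t i {k} k≤m = begin
    ∑[ j < k ] S₁ (suc t) (m * i + j)                ≡⟨ ∑<-cong k (λ j j<k → digit j (<-≤-trans j<k k≤m)) ⟩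
    ∑[ j < k ] (m * S₂ t i + suc j * S₁ t i)         ≡⟨ ∑<-arith k (m * S₂ t i) (S₁ t i) ⟩
    k * (m * S₂ t i) + triangle k * S₁ t i           ∎
    where
    open ≡-Reasoning
    digit : ∀ j → j < m → S₁ (suc t) (m * i + j) ≡ m * S₂ t i + suc j * S₁ t i
    digit j j<m = trans (cong (S₁ (suc t)) (+-comm (m * i) j)) (S₁-digit t i j<m)

  S₂-digit : ∀ t {r} q → r ≤ m →
    S₂ (suc t) (r + m * q) ≡ m * (m * ∑< q (S₂ t)) + triangle m * S₂ t q
                             + (r * (m * S₂ t q) + triangle r * S₁ t q)
  S₂-digit t {r} q r≤m = begin
    S₂ (suc t) (r + m * q)
      ≡⟨ ∑<-digit m q r (S₁ (suc t)) ⟩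
    ∑[ i < q ] ∑[ j < m ] S₁ (suc t) (m * i + j) + ∑[ j < r ] S₁ (suc t) (m * q + j)
      ≡⟨ cong₂ _+_ (∑<-cong q (λ i _ → S₁-block t i ≤-refl)) (S₁-block t q r≤m) ⟩
    ∑[ i < q ] (m * (m * S₂ t i) + triangle m * S₁ t i) + tail
      ≡⟨ cong (_+ tail) (∑<-distrib-+ q _ _) ⟩
    ∑[ i < q ] (m * (m * S₂ t i)) + ∑[ i < q ] (triangle m * S₁ t i) + tail
      ≡⟨ cong (λ z → z + ∑[ i < q ] (triangle m * S₁ t i) + tail) (∑<-*ˡ q m _) ⟩
    m * ∑[ i < q ] (m * S₂ t i) + ∑[ i < q ] (triangle m * S₁ t i) + tail
      ≡⟨ cong₂ (λ y z → m * y + z + tail) (∑<-*ˡ q m (S₂ t)) (∑<-*ˡ q (triangle m) (S₁ t)) ⟩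
    m * (m * ∑< q (S₂ t)) + triangle m * S₂ t q + tail ∎
    where
    open ≡-Reasoning
    tail : ℕ
    tail = r * (m * S₂ t q) + triangle r * S₁ t q

  m*S₂-digit : ∀ t {r} q → r ≤ m → m * S₂ (suc t) (r + m * q) ≋ m * (triangle r * S₁ t q) [mod μ₂ m ]
  m*S₂-digit t {r} q r≤m = begin
    m * S₂ (suc t) (r + m * q)
      ≡⟨ cong (m *_) (S₂-digit t q r≤m) ⟩
    m * (m * (m * A) + triangle m * S + (r * (m * S) + triangle r * S₁ t q))
      ≡⟨ regroup m A (triangle m) S r (triangle r) (S₁ t q) ⟩
    (m * m) * (m * A + r * S) + (m * triangle m) * S + m * (triangle r * S₁ t q)
      ≈⟨ ≋-+-multiple multiple ⟩
    m * (triangle r * S₁ t q) ∎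
    where
    open ≋-Reasoning (μ₂ m)
    A : ℕ
    A = ∑< q (S₂ t)
    S : ℕ
    S = S₂ t q
    regroup : ∀ m A T S r Tr C → m * (m * (m * A) + T * S + (r * (m * S) + Tr * C))
                                ≡ (m * m) * (m * A + r * S) + (m * T) * S + m * (Tr * C)
    regroup = solve-∀
    multiple : μ₂ m ℕ∣.∣ (m * m) * (m * A + r * S) + (m * triangle m) * S
    multiple = ℕ∣.∣m∣n⇒∣m+n (ℕ∣.∣m⇒∣m*n (m * A + r * S) (proj₁ (μ₂-divides m)))
                            (ℕ∣.∣m⇒∣m*n S (proj₂ (μ₂-divides m)))

  Digits : ∀ {k} → (Fin k → ℕ) → Set
  Digits a = ∀ j → a j < m

  fromDigits : ∀ {k} → (Fin k → ℕ) → ℕ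
  fromDigits a = sumF (λ j → a j * m ^ toℕ j)

  fromDigits-suc : ∀ {k} (a : Fin (suc k) → ℕ) → fromDigits a ≡ a zero + m * fromDigits (a ∘ suc)
  fromDigits-suc a = cong₂ _+_ (*-identityʳ (a zero)) (sumF-*ˡ-inner m (a ∘ suc) (λ j → m ^ toℕ j))

  fromDigits-one : (a : Fin 1 → ℕ) → fromDigits a ≡ a zero
  fromDigits-one a = trans (+-identityʳ _) (*-identityʳ (a zero))

  S₁-small : ∀ t {x} → x < m → S₁ t x ≡ suc x
  S₁-small t {x} x<m =
    trans (∑<-cong (suc x) (λ j j≤x → p-<m t (≤-<-trans (s≤s⁻¹ j≤x) x<m))) (S₁-zero x)

  S₂-zero : ∀ n → S₂ 0 n ≡ triangle n
  S₂-zero n = ∑<-cong n (λ j _ → S₁-zero j)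

  S₁≋∏⁺ : ∀ {k} (a : Fin k → ℕ) → Digits a → ∀ t → k ≤ suc t → S₁ t (fromDigits a) ≋ ∏⁺ a [mod m ]
  S₁≋∏⁺ {zero}        a _      t _ = ≡⇒≋ (p-<m t (>-nonZero⁻¹ m))
  S₁≋∏⁺ {suc zero}    a digits zero _ =
    ≡⇒≋ (trans (cong (S₁ 0) (fromDigits-one a)) (trans (S₁-small 0 (digits zero)) (sym (∏⁺-one a))))
  S₁≋∏⁺ {suc (suc k)} a _      zero (s≤s ())
  S₁≋∏⁺ {suc k}       a digits (suc t) (s≤s k≤t) = begin
    S₁ (suc t) (fromDigits a)            ≡⟨ cong (S₁ (suc t)) (fromDigits-suc a) ⟩
    S₁ (suc t) (a zero + m * q)          ≡⟨ S₁-digit t q (digits zero) ⟩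
    m * S₂ t q + suc (a zero) * S₁ t q   ≈⟨ ≋-+-multiple (ℕ∣.m∣m*n (S₂ t q)) ⟩
    suc (a zero) * S₁ t q                ≈⟨ ≋-*ˡ (suc (a zero)) (S₁≋∏⁺ (a ∘ suc) (digits ∘ suc) t k≤t) ⟩
    suc (a zero) * ∏⁺ (a ∘ suc)          ≡⟨ cong (_* ∏⁺ (a ∘ suc)) (+-comm 1 (a zero)) ⟩
    ∏⁺ a                                 ∎
    where
    open ≋-Reasoning m
    q : ℕ
    q = fromDigits (a ∘ suc)

  m*S₂≋ : ∀ {k} (a : Fin (suc k) → ℕ) → Digits a → ∀ t → k ≤ t →
    m * S₂ t (fromDigits a) ≋ m * (triangle (a zero) * ∏⁺ (a ∘ suc)) [mod μ₂ m ]
  m*S₂≋ {zero} a digits zero z≤n = ≡⇒≋ (cong (m *_) (begin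
    S₂ 0 (fromDigits a)     ≡⟨ cong (S₂ 0) (fromDigits-one a) ⟩
    S₂ 0 (a zero)           ≡⟨ S₂-zero (a zero) ⟩
    triangle (a zero)       ≡⟨ *-identityʳ (triangle (a zero)) ⟨
    triangle (a zero) * 1   ∎))
    where open ≡-Reasoning
  m*S₂≋ {k} a digits (suc t) k≤1+t = begin
    m * S₂ (suc t) (fromDigits a)              ≡⟨ cong (λ n → m * S₂ (suc t) n) (fromDigits-suc a) ⟩
    m * S₂ (suc t) (a zero + m * q)            ≈⟨ m*S₂-digit t q (<⇒≤ (digits zero)) ⟩
    m * (triangle (a zero) * S₁ t q)           ≈⟨ ≋-∣ (proj₁ (μ₂-divides m)) (≋-scale m lower) ⟩
    m * (triangle (a zero) * ∏⁺ (a ∘ suc))     ∎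
    where
    open ≋-Reasoning (μ₂ m)
    q : ℕ
    q = fromDigits (a ∘ suc)
    lower : triangle (a zero) * S₁ t q ≋ triangle (a zero) * ∏⁺ (a ∘ suc) [mod m ]
    lower = ≋-*ˡ (triangle (a zero)) (S₁≋∏⁺ (a ∘ suc) (digits ∘ suc) t k≤1+t)

  Φ : ∀ s → (Fin (suc s) → ℕ) → ℕ
  Φ s a = prodF (λ i → a i + 1)
        + m * sumF {s} (λ i → ((a (suc i) * (a (suc i) + 1)) / 2)
            * prodF (λ j → if (toℕ j ≡ᵇ toℕ (suc i)) ∨ (toℕ j ≡ᵇ toℕ i) then 1 else a j + 1))

  -- The first line of the proof is Φ (suc s) a unfolded: the summand i = 0 lacks the
  -- factors j = 0, 1, and every other summand contains the factor a₀ + 1.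
  Φ-suc : ∀ s (a : Fin (suc (suc s)) → ℕ) →
    Φ (suc s) a ≡ m * (triangle (a (suc zero)) * ∏⁺ (λ i → a (suc (suc i)))) + suc (a zero) * Φ s (a ∘ suc)
  Φ-suc s a = begin
    (a₀ + 1) * P′ + m * (T₁ * (1 * (1 * P″)) + sumF (λ i → u i * ((a₀ + 1) * v i)))
                                          ≡⟨ cong (λ z → (a₀ + 1) * P′ + m * (T₁ * (1 * (1 * P″)) + z))
                                                  (sumF-*ˡ-inner (a₀ + 1) u v) ⟩
    (a₀ + 1) * P′ + m * (T₁ * (1 * (1 * P″)) + (a₀ + 1) * S)
                                          ≡⟨ regroup a₀ P′ m T₁ P″ S ⟩
    m * (T₁ * P″) + suc a₀ * (P′ + m * S) ≡⟨ cong (λ z → m * (z * P″) + suc a₀ * (P′ + m * S))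
                                                  (triangle≡ (a (suc zero))) ⟨
    m * (triangle (a (suc zero)) * P″) + suc a₀ * Φ s (a ∘ suc) ∎
    where
    open ≡-Reasoning
    a₀ : ℕ
    a₀ = a zero
    P′ : ℕ
    P′ = ∏⁺ (a ∘ suc)
    P″ : ℕ
    P″ = ∏⁺ (λ i → a (suc (suc i)))
    T₁ : ℕ
    T₁ = (a (suc zero) * (a (suc zero) + 1)) / 2
    u v : Fin s → ℕ
    u i = (a (suc (suc i)) * (a (suc (suc i)) + 1)) / 2
    v i = prodF (λ j → if (toℕ j ≡ᵇ toℕ (suc i)) ∨ (toℕ j ≡ᵇ toℕ i) then 1 else a (suc j) + 1)
    S : ℕ
    S = sumF (λ i → u i * v i)
    regroup : ∀ a₀ P′ m T P″ S → (a₀ + 1) * P′ + m * (T * (1 * (1 * P″)) + (a₀ + 1) * S)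
                                ≡ m * (T * P″) + suc a₀ * (P′ + m * S)
    regroup = solve-∀

  S₁≋Φ : ∀ s (a : Fin (suc s) → ℕ) → Digits a → ∀ t → s ≤ t → S₁ t (fromDigits a) ≋ Φ s a [mod μ₂ m ]
  S₁≋Φ zero a digits t _ = ≡⇒≋ (begin
    S₁ t (fromDigits a)     ≡⟨ cong (S₁ t) (fromDigits-one a) ⟩
    S₁ t (a zero)           ≡⟨ S₁-small t (digits zero) ⟩
    suc (a zero)            ≡⟨ ∏⁺-one a ⟨
    ∏⁺ a                    ≡⟨ +-identityʳ (∏⁺ a) ⟨
    ∏⁺ a + 0                ≡⟨ cong (∏⁺ a +_) (*-zeroʳ m) ⟨
    Φ zero a                ∎)
    where open ≡-Reasoning
  S₁≋Φ (suc s) a digits (suc t) (s≤s s≤t) = begin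
    S₁ (suc t) (fromDigits a)                        ≡⟨ cong (S₁ (suc t)) (fromDigits-suc a) ⟩
    S₁ (suc t) (a zero + m * q)                      ≡⟨ S₁-digit t q (digits zero) ⟩
    m * S₂ t q + suc (a zero) * S₁ t q               ≈⟨ ≋-+ (m*S₂≋ (a ∘ suc) (digits ∘ suc) t s≤t)
                                                            (≋-*ˡ (suc (a zero)) lower) ⟩
    m * (triangle (a (suc zero)) * ∏⁺ (λ i → a (suc (suc i)))) + suc (a zero) * Φ s (a ∘ suc)
                                                     ≡⟨ Φ-suc s a ⟨
    Φ (suc s) a                                      ∎
    where
    open ≋-Reasoning (μ₂ m)
    q : ℕ
    q = fromDigits (a ∘ suc)
    lower : S₁ t q ≋ Φ s (a ∘ suc) [mod μ₂ m ]
    lower = S₁≋Φ s (a ∘ suc) (digits ∘ suc) t s≤t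

  b≡S₁ : 1 < m → ∀ n t → m * n ≤ t → b m (m * n) ≡ S₁ t n
  b≡S₁ 1<m n t mn≤t = begin
    reps m (m * n) (m * n)                   ≡⟨ reps≡p (m * n) (m * n) ⟩
    p (m * n) (m * n)                        ≡⟨ p-stable (suc t ∸ m * n) (m * n) mn<m^[1+mn] ⟨
    p (suc t ∸ m * n + m * n) (m * n)        ≡⟨ cong (λ k → p k (m * n)) (m∸n+n≡m (m≤n⇒m≤1+n mn≤t)) ⟩
    p (suc t) (m * n)                        ≡⟨⟩
    S₁ t (m * n / m)                         ≡⟨ cong (S₁ t) (trans (cong (_/ m) (*-comm m n)) (m*n/n≡m n m)) ⟩
    S₁ t n                                   ∎
    where
    open ≡-Reasoning
    mn<m^[1+mn] : m * n < m ^ suc (m * n)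
    mn<m^[1+mn] = <-trans (n<1+n (m * n)) (n<m^n 1<m (suc (m * n)))

theorem12 : (m n s : ℕ) → 1 < m → (a : Fin (suc s) → ℕ) → (∀ j → a j < m)
    → n ≡ sumF (λ j → a j * m ^ toℕ j)
    → b m (m * n) ≡ prodF (λ i → a i + 1)
        + m * sumF {s} (λ i → ((a (suc i) * (a (suc i) + 1)) / 2)
            * prodF (λ j → if (toℕ j ≡ᵇ toℕ (suc i)) ∨ (toℕ j ≡ᵇ toℕ i) then 1 else a j + 1))
        [mod μ₂ m ]
theorem12 m@(suc _) n s 1<m a digits refl = unwrap (begin
  b m (m * n)          ≡⟨ b≡S₁ m 1<m n t (m≤n+m (m * n) s) ⟩
  S₁ m t n             ≈⟨ S₁≋Φ m s a digits t (m≤m+n s (m * n)) ⟩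
  Φ m s a              ∎)
  where
  open ≋-Reasoning (μ₂ m)
  t : ℕ
  t = s + m * n
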